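{- For all $A,B\subseteq\omega$: $\overline{\rho}(B\triangleright A)\le\overline{\rho}(B)\,\overline{\rho}(A)$ and $\underline{\rho}(B\triangleright A)\ge\underline{\rho}(B)\,\underline{\rho}(A)$.
   Context: For $S\subseteq\omega$ write $S=\{s_0<s_1<s_2<\cdots\}$ (with $s_n$ defined for $n<|S|$). The set $B\triangleright A$ ("$B$ into $A$") is $\{a_{b_n} : n\in\omega,\ a_{b_n}\text{ defined}\}$, i.e. the elements of $A$ whose index (position in increasing order) lies in $B$. For $S\subseteq\omega$, $\rho_n(S)=|S\cap\{0,\dots,n-1\}|/n$, $\overline{\rho}(S)=\limsup_n\rho_n(S)$, $\underline{\rho}(S)=\liminf_n\rho_n(S)$. -}

module Defs where

open import Data.Bool using (Bool; true; false; if_then_else_; _∧_)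
open import Data.Nat using (ℕ; zero; suc; _≤_)
open import Data.Integer using (+_)
open import Data.Rational using (ℚ; 0ℚ; _/_; _+_; _-_)
  renaming (_≤_ to _≤ℚ_; _<_ to _<ℚ_)
open import Data.Product using (∃)

Subset : Set
Subset = ℕ → Bool

count : Subset → ℕ → ℕ
count S zero    = zero
count S (suc n) = (if S n then 1 else 0) Data.Nat.+ count S n

-- B ▷ A : x belongs iff x ∈ A and the index of x in A (= |A ∩ {0,…,x-1}|) lies in B.
-- This is exactly { a_{b_n} : a_{b_n} defined }.
_▷_ : Subset → Subset → Subset
(B ▷ A) x = A x ∧ B (count A x)

ρ : Subset → (n : ℕ) → .{{_ : Data.Nat.NonZero n}} → ℚ
ρ S n = (+ count S n) / n

UpperDensity≤ : Subset → ℚ → Set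
UpperDensity≤ S q =
  ∀ (ε : ℚ) → 0ℚ <ℚ ε → ∃ λ N → ∀ n → N ≤ n → ρ S (suc n) ≤ℚ q + ε

LowerDensity≥ : Subset → ℚ → Set
LowerDensity≥ S q =
  ∀ (ε : ℚ) → 0ℚ <ℚ ε → ∃ λ N → ∀ n → N ≤ n → q - ε ≤ℚ ρ S (suc n)

module Submission where

-- Everything rests on the counting identity  count (B ▷ A) = count B ∘ count A :
-- the elements of B ▷ A below n are the a_i below n whose index i is in B, and
-- there are count A n such indices.  Density bounds are statements about
-- eventual linear bounds  f m ≤ r·m  (resp. r·m ≤ f m)  on counting functions,
-- and such bounds compose.  For upper bounds, f (g m) ≤ a·(g m) ≤ a·b·m once
-- g m is past the threshold of f, and below that threshold f (g m) is bounded
-- by a constant, which any c > 0 absorbs as c·m → ∞.  For lower bounds,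
-- g m ≥ b·m → ∞ (b > 0) eventually passes the threshold of f.

open import Defs
open import Data.Product using (_×_)
open import Data.Rational using (ℚ; 0ℚ; _*_; _≤_)

open import Data.Bool using (true; false; if_then_else_)
open import Data.Empty using (⊥-elim)
open import Data.Integer as ℤ using (+_; -[1+_])
import Data.Integer.Properties as ℤP
open import Data.Nat as ℕ using (ℕ; zero; suc; z≤n; s≤s)
import Data.Nat.Properties as ℕP
open import Data.Product using (∃; _,_)
open import Data.Rational
  using (mkℚ; 1ℚ; _/_; _+_; _-_; -_; _<_; _⊓_; 1/_; toℚᵘ; NonZero; positive; nonNegative)
open import Data.Rational.Properties
open import Data.Rational.Solver using (module +-*-Solver)
open import Data.Rational.Unnormalised as ℚᵘ
  using (mkℚᵘ) renaming (_≃_ to _≃ᵘ_)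
import Data.Rational.Unnormalised.Properties as ℚᵘP
open import Data.Sum using (inj₁; inj₂)
open import Function using (_∘_)
open import Relation.Nullary using (yes; no)
open import Relation.Binary.PropositionalEquality

scaleˡ-≤ : ∀ {p q} r → 0ℚ ≤ r → p ≤ q → r * p ≤ r * q
scaleˡ-≤ r r≥0 = *-monoˡ-≤-nonNeg r {{nonNegative r≥0}}

scaleʳ-≤ : ∀ {p q} r → 0ℚ ≤ r → p ≤ q → p * r ≤ q * r
scaleʳ-≤ r r≥0 = *-monoʳ-≤-nonNeg r {{nonNegative r≥0}}

-- n ↦ n/1.  It is opaque: unfolding it exposes a gcd normalisation that
-- does not compute on variables; all its properties go through ℚᵘ.
opaque
  ι : ℕ → ℚ
  ι m = + m / 1

  toℚᵘ-ι : ∀ m → toℚᵘ (ι m) ≃ᵘ mkℚᵘ (+ m) 0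
  toℚᵘ-ι m = toℚᵘ-fromℚᵘ (mkℚᵘ (+ m) 0)

  ι-zero : ι 0 ≡ 0ℚ
  ι-zero = refl

ι-mono : ∀ {m n} → m ℕ.≤ n → ι m ≤ ι n
ι-mono {m} {n} m≤n =
  toℚᵘ-cancel-≤ (ℚᵘP.≤-respˡ-≃ (ℚᵘP.≃-sym (toℚᵘ-ι m)) (ℚᵘP.≤-respʳ-≃ (ℚᵘP.≃-sym (toℚᵘ-ι n))
    (ℚᵘ.*≤* (subst₂ ℤ._≤_ (sym (ℤP.*-identityʳ (+ m))) (sym (ℤP.*-identityʳ (+ n))) (ℤ.+≤+ m≤n)))))

ι-cancel : ∀ {m n} → ι m ≤ ι n → m ℕ.≤ n
ι-cancel {m} {n} ιm≤ιn
  with ℚᵘP.≤-respˡ-≃ (toℚᵘ-ι m) (ℚᵘP.≤-respʳ-≃ (toℚᵘ-ι n) (toℚᵘ-mono-≤ ιm≤ιn))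
... | ℚᵘ.*≤* m*1≤n*1
  with subst₂ ℤ._≤_ (ℤP.*-identityʳ (+ m)) (ℤP.*-identityʳ (+ n)) m*1≤n*1
... | ℤ.+≤+ m≤n = m≤n

ι-nonneg : ∀ m → 0ℚ ≤ ι m
ι-nonneg m = subst (_≤ ι m) ι-zero (ι-mono z≤n)

ι-pos : ∀ n → 0ℚ < ι (suc n)
ι-pos n = toℚᵘ-cancel-< (ℚᵘP.<-respʳ-≃ (ℚᵘP.≃-sym (toℚᵘ-ι (suc n)))
  (ℚᵘ.*<* (subst (ℤ._<_ _) (sym (ℤP.*-identityʳ (+ suc n))) (ℤ.+<+ (s≤s z≤n)))))

ι-unbounded : ∀ x → ∃ λ m → x ≤ ι m
ι-unbounded (mkℚ (+ k) d _) = k , toℚᵘ-cancel-≤ (ℚᵘP.≤-respʳ-≃ (ℚᵘP.≃-sym (toℚᵘ-ι k))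
  (ℚᵘ.*≤* (subst₂ ℤ._≤_ (sym (ℤP.*-identityʳ (+ k))) (ℤP.pos-* k (suc d))
    (ℤ.+≤+ (ℕP.m≤m*n k (suc d))))))
ι-unbounded x@(mkℚ -[1+ _ ] _ _) = 0 , ≤-trans (nonPositive⁻¹ x) (ι-nonneg 0)

archimedean : ∀ {r} → 0ℚ < r → ∀ K → ∃ λ N → ∀ m → N ℕ.≤ m → ι K ≤ r * ι m
archimedean {r} r>0 K = let N , K/r≤N = ι-unbounded (ι K * 1/ r) in N , λ m N≤m → begin
  ι K               ≡⟨ sym K/r*r≡K ⟩
  ι K * 1/ r * r    ≤⟨ scaleʳ-≤ r (<⇒≤ r>0) (≤-trans K/r≤N (ι-mono N≤m)) ⟩
  ι m * r           ≡⟨ *-comm (ι m) r ⟩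
  r * ι m           ∎
  where
  open ≤-Reasoning
  instance
    r≢0 : NonZero r
    r≢0 = pos⇒nonZero r {{positive r>0}}
  K/r*r≡K : ι K * 1/ r * r ≡ ι K
  K/r*r≡K = trans (*-assoc (ι K) (1/ r) r) (trans (cong (ι K *_) (*-inverseˡ r)) (*-identityʳ (ι K)))

ratio-scaled : ∀ k n → (+ k / suc n) * ι (suc n) ≡ ι k
ratio-scaled k n = toℚᵘ-injective (ℚᵘP.≃-trans (toℚᵘ-homo-* (+ k / suc n) (ι (suc n)))
  (ℚᵘP.≃-trans (ℚᵘP.*-cong (toℚᵘ-fromℚᵘ (mkℚᵘ (+ k) n)) (toℚᵘ-ι (suc n)))
    (ℚᵘP.≃-trans (ℚᵘ.*≡* (ℤP.*-assoc (+ k) (+ suc n) (+ 1))) (ℚᵘP.≃-sym (toℚᵘ-ι k)))))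

ratio≤⇒ : ∀ {r} k n → (+ k / suc n) ≤ r → ι k ≤ r * ι (suc n)
ratio≤⇒ k n h = subst (_≤ _) (ratio-scaled k n) (scaleʳ-≤ (ι (suc n)) (ι-nonneg (suc n)) h)

ratio≤⇐ : ∀ {r} k n → ι k ≤ r * ι (suc n) → (+ k / suc n) ≤ r
ratio≤⇐ k n h = *-cancelʳ-≤-pos (ι (suc n)) {{positive (ι-pos n)}}
  (subst (_≤ _) (sym (ratio-scaled k n)) h)

ratio≥⇒ : ∀ {r} k n → r ≤ (+ k / suc n) → r * ι (suc n) ≤ ι k
ratio≥⇒ k n h = subst (_ ≤_) (ratio-scaled k n) (scaleʳ-≤ (ι (suc n)) (ι-nonneg (suc n)) h)

ratio≥⇐ : ∀ {r} k n → r * ι (suc n) ≤ ι k → r ≤ (+ k / suc n)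
ratio≥⇐ k n h = *-cancelʳ-≤-pos (ι (suc n)) {{positive (ι-pos n)}}
  (subst (_ ≤_) (sym (ratio-scaled k n)) h)

ratio-nonneg : ∀ k n → 0ℚ ≤ (+ k / suc n)
ratio-nonneg k n = ratio≥⇐ k n (subst (_≤ ι k) (sym (*-zeroˡ (ι (suc n)))) (ι-nonneg k))

count-≤ : ∀ S n → count S n ℕ.≤ n
count-≤ S zero    = z≤n
count-≤ S (suc n) with S n
... | true  = s≤s (count-≤ S n)
... | false = ℕP.m≤n⇒m≤1+n (count-≤ S n)

count-▷ : ∀ A B n → count (B ▷ A) n ≡ count B (count A n)
count-▷ A B zero = refl
count-▷ A B (suc n) with A n
... | true  = cong ((if B (count A n) then 1 else 0) ℕ.+_) (count-▷ A B n)
... | false = count-▷ A B n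

EventuallyAtMost : (ℕ → ℕ) → ℚ → Set
EventuallyAtMost f r = ∃ λ N → ∀ m → N ℕ.≤ m → ι (f m) ≤ r * ι m

EventuallyAtLeast : (ℕ → ℕ) → ℚ → Set
EventuallyAtLeast f r = ∃ λ N → ∀ m → N ℕ.≤ m → r * ι m ≤ ι (f m)

atMost-cong : ∀ {f g r} → (∀ m → f m ≡ g m) → EventuallyAtMost f r → EventuallyAtMost g r
atMost-cong {r = r} f≗g (N , h) = N , λ m N≤m → subst (λ k → ι k ≤ r * ι m) (f≗g m) (h m N≤m)

atLeast-cong : ∀ {f g r} → (∀ m → f m ≡ g m) → EventuallyAtLeast f r → EventuallyAtLeast g r
atLeast-cong {r = r} f≗g (N , h) = N , λ m N≤m → subst (λ k → r * ι m ≤ ι k) (f≗g m) (h m N≤m)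

atLeast-nonpos : ∀ {f r} → r ≤ 0ℚ → EventuallyAtLeast f r
atLeast-nonpos {f} {r} r≤0 = 0 , λ m _ → begin
  r * ι m     ≤⟨ scaleʳ-≤ (ι m) (ι-nonneg m) r≤0 ⟩
  0ℚ * ι m    ≡⟨ *-zeroˡ (ι m) ⟩
  0ℚ          ≤⟨ ι-nonneg (f m) ⟩
  ι (f m)     ∎
  where open ≤-Reasoning

-- Density bounds are eventual linear bounds on the counting function; the
-- threshold moves by one because ρ S (suc n) samples count S (suc n).
upper⇒atMost : ∀ {S r δ} → UpperDensity≤ S r → 0ℚ < δ → EventuallyAtMost (count S) (r + δ)
upper⇒atMost {S} {r} {δ} hyp δ>0 with hyp δ δ>0
... | N , h = suc N , bound
  where
  bound : ∀ m → suc N ℕ.≤ m → ι (count S m) ≤ (r + δ) * ι m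
  bound (suc n) (s≤s N≤n) = ratio≤⇒ (count S (suc n)) n (h n N≤n)

atMost⇒upper : ∀ {S s} → EventuallyAtMost (count S) s → ∃ λ N → ∀ n → N ℕ.≤ n → ρ S (suc n) ≤ s
atMost⇒upper {S} (N , h) = N , λ n N≤n →
  ratio≤⇐ (count S (suc n)) n (h (suc n) (ℕP.m≤n⇒m≤1+n N≤n))

lower⇒atLeast : ∀ {S r δ} → LowerDensity≥ S r → 0ℚ < δ → EventuallyAtLeast (count S) (r - δ)
lower⇒atLeast {S} {r} {δ} hyp δ>0 with hyp δ δ>0
... | N , h = suc N , bound
  where
  bound : ∀ m → suc N ℕ.≤ m → (r - δ) * ι m ≤ ι (count S m)
  bound (suc n) (s≤s N≤n) = ratio≥⇒ (count S (suc n)) n (h n N≤n)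

atLeast⇒lower : ∀ {S s} → EventuallyAtLeast (count S) s → ∃ λ N → ∀ n → N ℕ.≤ n → s ≤ ρ S (suc n)
atLeast⇒lower {S} (N , h) = N , λ n N≤n →
  ratio≥⇐ (count S (suc n)) n (h (suc n) (ℕP.m≤n⇒m≤1+n N≤n))

-- Upper bounds compose, with any positive slack c ≥ a·b; f m ≤ m controls
-- f (g m) while g m is still below the threshold of f.
atMost-∘ : ∀ {f g : ℕ → ℕ} {a b c} → (∀ m → f m ℕ.≤ m) → 0ℚ ≤ a → 0ℚ < c → a * b ≤ c →
  EventuallyAtMost f a → EventuallyAtMost g b → EventuallyAtMost (f ∘ g) c
atMost-∘ {f} {g} {a} {b} {c} f≤id a≥0 c>0 ab≤c (Nf , hf) (Ng , hg) with archimedean c>0 Nf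
... | Nc , hc = Ng ℕ.⊔ Nc , bound
  where
  open ≤-Reasoning
  bound : ∀ m → Ng ℕ.⊔ Nc ℕ.≤ m → ι (f (g m)) ≤ c * ι m
  bound m N≤m with g m ℕ.≤? Nf
  ... | yes gm≤Nf = begin
    ι (f (g m))   ≤⟨ ι-mono (ℕP.≤-trans (f≤id (g m)) gm≤Nf) ⟩
    ι Nf          ≤⟨ hc m (ℕP.m⊔n≤o⇒n≤o Ng Nc N≤m) ⟩
    c * ι m       ∎
  ... | no gm≰Nf = begin
    ι (f (g m))   ≤⟨ hf (g m) (ℕP.<⇒≤ (ℕP.≰⇒> gm≰Nf)) ⟩
    a * ι (g m)   ≤⟨ scaleˡ-≤ a a≥0 (hg m (ℕP.m⊔n≤o⇒m≤o Ng Nc N≤m)) ⟩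
    a * (b * ι m) ≡⟨ sym (*-assoc a b (ι m)) ⟩
    a * b * ι m   ≤⟨ scaleʳ-≤ (ι m) (ι-nonneg m) ab≤c ⟩
    c * ι m       ∎

-- Lower bounds compose when the inner growth rate is positive: g m ≥ b·m
-- eventually exceeds the threshold of f.
atLeast-∘-pos : ∀ {f g : ℕ → ℕ} {a b c} → 0ℚ ≤ a → 0ℚ < b → c ≤ a * b →
  EventuallyAtLeast f a → EventuallyAtLeast g b → EventuallyAtLeast (f ∘ g) c
atLeast-∘-pos {f} {g} {a} {b} {c} a≥0 b>0 c≤ab (Nf , hf) (Ng , hg) with archimedean b>0 Nf
... | Nc , hc = Ng ℕ.⊔ Nc , bound
  where
  open ≤-Reasoning
  bound : ∀ m → Ng ℕ.⊔ Nc ℕ.≤ m → c * ι m ≤ ι (f (g m))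
  bound m N≤m = begin
    c * ι m       ≤⟨ scaleʳ-≤ (ι m) (ι-nonneg m) c≤ab ⟩
    a * b * ι m   ≡⟨ *-assoc a b (ι m) ⟩
    a * (b * ι m) ≤⟨ scaleˡ-≤ a a≥0 bm≤gm ⟩
    a * ι (g m)   ≤⟨ hf (g m) (ι-cancel (≤-trans (hc m (ℕP.m⊔n≤o⇒n≤o Ng Nc N≤m)) bm≤gm)) ⟩
    ι (f (g m))   ∎
    where
    bm≤gm : b * ι m ≤ ι (g m)
    bm≤gm = hg m (ℕP.m⊔n≤o⇒m≤o Ng Nc N≤m)

factor-pos : ∀ {a b} → 0ℚ ≤ a → 0ℚ < a * b → 0ℚ < b
factor-pos {a} {b} a≥0 ab>0 with 0ℚ <? b
... | yes b>0 = b>0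
... | no b≯0  = ⊥-elim (<-irrefl refl (<-≤-trans ab>0 ab≤0))
  where
  ab≤0 : a * b ≤ 0ℚ
  ab≤0 = subst (a * b ≤_) (*-zeroʳ a) (scaleˡ-≤ a a≥0 (≮⇒≥ b≯0))

-- Lower bounds compose in general: a nonpositive target is trivial, and a
-- positive one forces b > 0.
atLeast-∘ : ∀ {f g : ℕ → ℕ} {a b c} → 0ℚ ≤ a → c ≤ a * b →
  EventuallyAtLeast f a → EventuallyAtLeast g b → EventuallyAtLeast (f ∘ g) c
atLeast-∘ {c = c} a≥0 c≤ab hf hg with c ≤? 0ℚ
... | yes c≤0 = atLeast-nonpos c≤0
... | no c≰0  = atLeast-∘-pos a≥0 (factor-pos a≥0 (<-≤-trans (≰⇒> c≰0) c≤ab)) c≤ab hf hg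

≤-by-ε : ∀ {x y} → (∀ ε → 0ℚ < ε → x ≤ y + ε) → x ≤ y
≤-by-ε {x} {y} h with x ≤? y
... | yes x≤y = x≤y
... | no x≰y with <-dense (≰⇒> x≰y)
...   | m , y<m , m<x = ⊥-elim (<-irrefl refl (<-≤-trans m<x x≤m))
  where
  y+[m-y]≡m : y + (m - y) ≡ m
  y+[m-y]≡m = solve 2 (λ y m → y :+ (m :- y) := m) refl y m
    where open +-*-Solver
  m-y>0 : 0ℚ < m - y
  m-y>0 = subst (_< m - y) (+-inverseʳ y) (+-monoˡ-< (- y) y<m)
  x≤m : x ≤ m
  x≤m = subst (x ≤_) y+[m-y]≡m (h (m - y) m-y>0)

upper-nonneg : ∀ {S p} → UpperDensity≤ S p → 0ℚ ≤ p
upper-nonneg {S} {p} hyp = ≤-by-ε λ ε ε>0 → nonneg-below (hyp ε ε>0)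
  where
  nonneg-below : ∀ {s} → (∃ λ N → ∀ n → N ℕ.≤ n → ρ S (suc n) ≤ s) → 0ℚ ≤ s
  nonneg-below (N , h) = ≤-trans (ratio-nonneg (count S (suc N)) N) (h N ℕP.≤-refl)

-- The weight p+q+1 with which δ enters the product bounds below.
0<p+q+1 : ∀ {p q} → 0ℚ ≤ p → 0ℚ ≤ q → 0ℚ < p + q + 1ℚ
0<p+q+1 p≥0 q≥0 = +-mono-≤-< (+-mono-≤ p≥0 q≥0) (positive⁻¹ 1ℚ)

-- Given c, ε, t > 0 there is δ ∈ (0, c] with δ·t ≤ ε, namely c ⊓ ε/t.
small-δ : ∀ {c ε t} → 0ℚ < c → 0ℚ < ε → 0ℚ < t → ∃ λ δ → 0ℚ < δ × δ ≤ c × δ * t ≤ ε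
small-δ {c} {ε} {t} c>0 ε>0 t>0 = c ⊓ ε/t , δ>0 , p⊓q≤p c ε/t , δt≤ε
  where
  instance
    t≢0 : NonZero t
    t≢0 = pos⇒nonZero t {{positive t>0}}
  ε/t = ε * 1/ t
  ε/t>0 : 0ℚ < ε/t
  ε/t>0 = positive⁻¹ _ {{pos*pos⇒pos ε {{positive ε>0}} (1/ t) {{1/pos⇒pos t {{positive t>0}}}}}}
  δ>0 : 0ℚ < c ⊓ ε/t
  δ>0 with ⊓-sel c ε/t
  ... | inj₁ δ≡c = subst (0ℚ <_) (sym δ≡c) c>0
  ... | inj₂ δ≡ε/t = subst (0ℚ <_) (sym δ≡ε/t) ε/t>0
  δt≤ε : c ⊓ ε/t * t ≤ ε
  δt≤ε = ≤-trans (scaleʳ-≤ t (<⇒≤ t>0) (p⊓q≤q c ε/t)) (≤-reflexive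
    (trans (*-assoc ε (1/ t) t) (trans (cong (ε *_) (*-inverseˡ t)) (*-identityʳ ε))))

upper-slack : ∀ {p q ε δ} → 0ℚ ≤ δ → δ ≤ 1ℚ → δ * (p + q + 1ℚ) ≤ ε →
  (p + δ) * (q + δ) ≤ p * q + ε
upper-slack {p} {q} {ε} {δ} δ≥0 δ≤1 δt≤ε = begin
  (p + δ) * (q + δ)       ≡⟨ expand ⟩
  p * q + δ * (p + q + δ) ≤⟨ +-monoʳ-≤ (p * q) (scaleˡ-≤ δ δ≥0 (+-monoʳ-≤ (p + q) δ≤1)) ⟩
  p * q + δ * (p + q + 1ℚ) ≤⟨ +-monoʳ-≤ (p * q) δt≤ε ⟩
  p * q + ε               ∎
  where
  open ≤-Reasoning
  open +-*-Solver
  expand : (p + δ) * (q + δ) ≡ p * q + δ * (p + q + δ)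
  expand = solve 3 (λ p q δ → (p :+ δ) :* (q :+ δ) := p :* q :+ δ :* (p :+ q :+ δ)) refl p q δ

lower-slack : ∀ {p q ε δ} → 0ℚ ≤ δ → δ * (p + q + 1ℚ) ≤ ε → p * q - ε ≤ (p - δ) * (q - δ)
lower-slack {p} {q} {ε} {δ} δ≥0 δt≤ε = begin
  p * q - ε                                ≤⟨ +-monoʳ-≤ (p * q) (neg-antimono-≤ δt≤ε) ⟩
  p * q - δ * (p + q + 1ℚ)                 ≡⟨ sym (+-identityʳ _) ⟩
  p * q - δ * (p + q + 1ℚ) + 0ℚ            ≤⟨ +-monoʳ-≤ (p * q - δ * (p + q + 1ℚ)) δ[δ+1]≥0 ⟩
  p * q - δ * (p + q + 1ℚ) + δ * (δ + 1ℚ)  ≡⟨ sym expand ⟩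
  (p - δ) * (q - δ)                        ∎
  where
  open ≤-Reasoning
  open +-*-Solver
  expand : (p - δ) * (q - δ) ≡ p * q - δ * (p + q + 1ℚ) + δ * (δ + 1ℚ)
  expand = solve 3 (λ p q δ → (p :- δ) :* (q :- δ)
    := p :* q :- δ :* (p :+ q :+ con 1ℚ) :+ δ :* (δ :+ con 1ℚ)) refl p q δ
  δ[δ+1]≥0 : 0ℚ ≤ δ * (δ + 1ℚ)
  δ[δ+1]≥0 = subst (_≤ δ * (δ + 1ℚ)) (*-zeroʳ δ) (scaleˡ-≤ δ δ≥0 (+-mono-≤ δ≥0 (nonNegative⁻¹ 1ℚ)))

upper : (A B : Subset) (p q : ℚ) → UpperDensity≤ B p → UpperDensity≤ A q →
  UpperDensity≤ (B ▷ A) (p * q)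
upper A B p q hB hA ε ε>0 =
  atMost⇒upper {S = B ▷ A} (atMost-cong {r = p * q + ε} (sym ∘ count-▷ A B) composed)
  where
  p≥0 : 0ℚ ≤ p
  p≥0 = upper-nonneg {B} hB
  q≥0 : 0ℚ ≤ q
  q≥0 = upper-nonneg {A} hA
  pq+ε>0 : 0ℚ < p * q + ε
  pq+ε>0 = +-mono-≤-< (nonNegative⁻¹ (p * q)
    {{nonNeg*nonNeg⇒nonNeg p {{nonNegative p≥0}} q {{nonNegative q≥0}}}}) ε>0
  composed : EventuallyAtMost (count B ∘ count A) (p * q + ε)
  composed =
    let δ , δ>0 , δ≤1 , δt≤ε = small-δ (positive⁻¹ 1ℚ) ε>0 (0<p+q+1 p≥0 q≥0)
    in atMost-∘ {a = p + δ} {b = q + δ} (count-≤ B) (+-mono-≤ p≥0 (<⇒≤ δ>0)) pq+ε>0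
         (upper-slack {p} {q} (<⇒≤ δ>0) δ≤1 δt≤ε)
         (upper⇒atMost {r = p} hB δ>0) (upper⇒atMost {r = q} hA δ>0)

-- ρ̲(B ▷ A) ≥ ρ̲(B)·ρ̲(A): compose count B ≥ (p-δ)·m with count A ≥ (q-δ)·m,
-- taking δ ≤ p; if p = 0 the bound p·q - ε is negative and trivial.
lower : (A B : Subset) (p q : ℚ) → 0ℚ ≤ p → 0ℚ ≤ q → LowerDensity≥ B p → LowerDensity≥ A q →
  LowerDensity≥ (B ▷ A) (p * q)
lower A B p q p≥0 q≥0 hB hA ε ε>0 =
  atLeast⇒lower {S = B ▷ A} (atLeast-cong {r = p * q - ε} (sym ∘ count-▷ A B) composed)
  where
  composed : EventuallyAtLeast (count B ∘ count A) (p * q - ε)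
  composed with 0ℚ <? p
  ... | no p≯0 = atLeast-nonpos (begin
    p * q - ε    ≡⟨ cong (λ x → x * q - ε) (≤-antisym (≮⇒≥ p≯0) p≥0) ⟩
    0ℚ * q - ε   ≡⟨ cong (λ x → x - ε) (*-zeroˡ q) ⟩
    0ℚ - ε       ≡⟨ +-identityˡ (- ε) ⟩
    - ε          ≤⟨ neg-antimono-≤ (<⇒≤ ε>0) ⟩
    0ℚ           ∎)
    where open ≤-Reasoning
  ... | yes p>0 =
    let δ , δ>0 , δ≤p , δt≤ε = small-δ p>0 ε>0 (0<p+q+1 p≥0 q≥0)
    in atLeast-∘ {a = p - δ} {b = q - δ} (subst (_≤ p - δ) (+-inverseʳ δ) (+-monoˡ-≤ (- δ) δ≤p))
         (lower-slack {p} {q} (<⇒≤ δ>0) δt≤ε)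
         (lower⇒atLeast {r = p} hB δ>0) (lower⇒atLeast {r = q} hA δ>0)

lemma3p2 : (A B : Subset) →
    ((p q : ℚ) → UpperDensity≤ B p → UpperDensity≤ A q → UpperDensity≤ (B ▷ A) (p * q))
    × ((p q : ℚ) → 0ℚ ≤ p → 0ℚ ≤ q → LowerDensity≥ B p → LowerDensity≥ A q → LowerDensity≥ (B ▷ A) (p * q))
lemma3p2 A B = upper A B , lower A B
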